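{- Let $(X,I,Y,R)$ be a polarity with a relation $R$ of sort type $\sigma=(i_{n+1};i_1\cdots i_n)$ and let $k\in\{1,\ldots,n\}$. For Galois sets $E_j\in\mathcal G(Z_{i_j})$ ($j\ne k$) and $G\in\mathcal G(Z_{i_{n+1}})$ define $$\beta^k_{R/}(\vec E[G]_k)=\bigcup\{F\in\mathcal G(Z_{i_k}) : \alpha_R(\vec E[F]_k)\subseteq G\}.$$ Suppose $\overline\alpha_R$ is residuated in the $k$-th argument place, i.e. there is a map $\overline\beta$ such that $\overline\alpha_R(\vec E[F]_k)\subseteq G$ iff $F\subseteq\overline\beta(\vec E[G]_k)$ for all such $\vec E$, $G$ and all $F\in\mathcal G(Z_{i_k})$. Then for all such $\vec E,G$, the set $\beta^k_{R/}(\vec E[G]_k)$ is a Galois set (so the union above is a join in $\mathcal G(Z_{i_k})$), and $\beta^k_{R/}$ is the $k$-th residual of $\overline\alpha_R$: $\overline\alpha_R(\vec E[F]_k)\subseteq G$ iff $F\subseteq\beta^k_{R/}(\vec E[G]_k)$ for all $F\in\mathcal G(Z_{i_k})$.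
   Context: A polarity is a triple $(X,I,Y)$ with $X,Y$ nonempty sets and $I\subseteq X\times Y$; write $x\perp y$ iff $(x,y)\notin I$. For $U\subseteq X$, $V\subseteq Y$ put $U^{\perp}=\{y\in Y: x\perp y\ \forall x\in U\}$, ${}^{\perp}V=\{x\in X: x\perp y\ \forall y\in V\}$. $A\subseteq X$ is stable if $A={}^{\perp}(A^{\perp})$; $B\subseteq Y$ is co-stable if $B=({}^{\perp}B)^{\perp}$ (Galois sets). $\mathcal G(X),\mathcal G(Y)$ are the complete lattices of stable, resp. co-stable sets under inclusion (joins are Galois closures of unions). Priming: $U'=U^\perp$ for $U\subseteq X$, $V'={}^\perp V$ for $V\subseteq Y$. Sorts $Z_1=X$, $Z_\partial=Y$. A relation of sort type $(i_{n+1};i_1\cdots i_n)$ is $R\subseteq Z_{i_{n+1}}\times\prod_{j=1}^n Z_{i_j}$, $R\vec u=\{w: wR\vec u\}$. $\vec E[F]_k$ is the tuple with $k$-th entry $F$. Image operator: $\alpha_R(\vec W)=\bigcup\{R\vec w: w_j\in W_j\ \forall j\}$ for $W_j\subseteq Z_{i_j}$; $\overline\alpha_R(\vec F)=(\alpha_R(\vec F))''$ for Galois sets $F_j\in\mathcal G(Z_{i_j})$. -}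

module Defs where

open import Level using (Level; _⊔_) renaming (zero to 0ℓ; suc to lsuc)
open import Data.Nat using (ℕ)
open import Data.Fin using (Fin; _≟_)
open import Data.Product using (Σ; _×_)
open import Relation.Nullary using (¬_; yes; no)
open import Relation.Unary using (Pred; _⊆_)
open import Relation.Binary.PropositionalEquality using (refl)

data Sort : Set where
  s1 s∂ : Sort

module Polarity (X Y : Set) (I : X → Y → Set) where

  _⊥_ : X → Y → Set
  x ⊥ y = ¬ I x y

  Z : Sort → Set
  Z s1 = X
  Z s∂ = Y

  flip : Sort → Sort
  flip s1 = s∂
  flip s∂ = s1

  _^⊥ : ∀ {ℓ} → Pred X ℓ → Pred Y ℓ
  (U ^⊥) y = ∀ x → U x → x ⊥ y

  ⊥^_ : ∀ {ℓ} → Pred Y ℓ → Pred X ℓ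
  (⊥^ V) x = ∀ y → V y → x ⊥ y

  prime : ∀ {ℓ} (s : Sort) → Pred (Z s) ℓ → Pred (Z (flip s)) ℓ
  prime s1 U = U ^⊥
  prime s∂ V = ⊥^ V

  closure : ∀ {ℓ} (s : Sort) → Pred (Z s) ℓ → Pred (Z s) ℓ
  closure s1 U = ⊥^ (U ^⊥)
  closure s∂ V = (⊥^ V) ^⊥

  Galois : ∀ {ℓ} (s : Sort) → Pred (Z s) ℓ → Set ℓ
  Galois s A = (A ⊆ closure s A) × (closure s A ⊆ A)

  module Rel (n : ℕ) (i : Fin n → Sort) (o : Sort)
             (R : Z o → ((j : Fin n) → Z (i j)) → Set) where

    Tuple : (ℓ : Level) → Set (lsuc ℓ)
    Tuple ℓ = (j : Fin n) → Pred (Z (i j)) ℓ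

    upd : ∀ {ℓ} → Tuple ℓ → (k : Fin n) → Pred (Z (i k)) ℓ → Tuple ℓ
    upd E k F j with k ≟ j
    ... | yes refl = F
    ... | no _ = E j

    α : ∀ {ℓ} → Tuple ℓ → Pred (Z o) ℓ
    α W w = Σ ((j : Fin n) → Z (i j)) (λ u → ((j : Fin n) → W j (u j)) × R w u)

    ᾱ : ∀ {ℓ} → Tuple ℓ → Pred (Z o) ℓ
    ᾱ W = closure o (α W)

    -- β^k_{R/}(\vec E[G]_k) = ⋃ { F ∈ G(Z_{i_k}) : α_R(\vec E[F]_k) ⊆ G }
    -- (the k-th entry of E is irrelevant: it is overwritten)
    βR/ : (k : Fin n) → Tuple 0ℓ → Pred (Z o) 0ℓ → Pred (Z (i k)) (lsuc 0ℓ)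
    βR/ k E G z = Σ (Pred (Z (i k)) 0ℓ) (λ F →
                    Galois (i k) F × (α (upd E k F) ⊆ G) × F z)

{-# OPTIONS --safe #-}
module Submission where

open import Defs
open import Level using (_⊔_) renaming (zero to 0ℓ; suc to lsuc)
open import Data.Nat using (ℕ)
open import Data.Fin using (Fin)
open import Data.Product using (Σ; _×_; _,_)
open import Relation.Binary.PropositionalEquality using (_≢_)
open import Relation.Unary using (Pred; _⊆_; _≐_)
open import Function.Bundles using (_⇔_; mk⇔; Equivalence)
open import Function.Construct.Composition using (_⇔-∘_)

-- Being a residual is invariant under ≐, so it suffices to show that βR/ is ≐ to the given
-- residual β̄. The union βR/ contains β̄, because β̄ is itself a Galois set F with
-- α(E[F]) ⊆ G; and it is contained in β̄, because for Galois G the conditions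
-- α(E[F]) ⊆ G and ᾱ(E[F]) ⊆ G coincide, so every F in the union lies below β̄.

⊆-respʳ-≐ : ∀ {a ℓ₁ ℓ₂ ℓ₃} {A : Set a} {P : Pred A ℓ₁} {Q : Pred A ℓ₂} {R : Pred A ℓ₃}
          → Q ≐ R → (P ⊆ Q) ⇔ (P ⊆ R)
⊆-respʳ-≐ {P = P} {Q = Q} {R = R} (Q⊆R , R⊆Q) =
  mk⇔ {A = P ⊆ Q} {B = P ⊆ R} (λ P⊆Q x∈P → Q⊆R (P⊆Q x∈P)) (λ P⊆R x∈P → R⊆Q (P⊆R x∈P))

module ClosureProperties (X Y : Set) (I : X → Y → Set) where
  open Polarity X Y I

  closure-extensive : ∀ {ℓ} (s : Sort) {A : Pred (Z s) ℓ} → A ⊆ closure s A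
  closure-extensive s1 a y a⊥ = a⊥ _ a
  closure-extensive s∂ a x a⊥ = a⊥ _ a

  closure-monotone : ∀ {ℓ ℓ′} (s : Sort) {A : Pred (Z s) ℓ} {B : Pred (Z s) ℓ′}
                   → A ⊆ B → closure s A ⊆ closure s B
  closure-monotone s1 A⊆B c y B⊥ = c y (λ x a → B⊥ x (A⊆B a))
  closure-monotone s∂ A⊆B c x B⊥ = c x (λ y a → B⊥ y (A⊆B a))

  closure-least : ∀ {ℓ ℓ′} (s : Sort) {A : Pred (Z s) ℓ} {B : Pred (Z s) ℓ′}
                → Galois s B → A ⊆ B → closure s A ⊆ B
  closure-least s (_ , closedB) A⊆B x∈A″ = closedB (closure-monotone s A⊆B x∈A″)

  closure⊆⇔⊆ : ∀ {ℓ ℓ′} (s : Sort) {A : Pred (Z s) ℓ} {B : Pred (Z s) ℓ′}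
             → Galois s B → (closure s A ⊆ B) ⇔ (A ⊆ B)
  closure⊆⇔⊆ s {A} {B} galB =
    mk⇔ {A = closure s A ⊆ B} {B = A ⊆ B}
        (λ A″⊆B x∈A → A″⊆B (closure-extensive s x∈A)) (closure-least s galB)

  Galois-resp-≐ : ∀ {ℓ ℓ′} (s : Sort) {A : Pred (Z s) ℓ} {B : Pred (Z s) ℓ′}
                → A ≐ B → Galois s A → Galois s B
  Galois-resp-≐ s (A⊆B , B⊆A) (_ , closedA) =
    closure-extensive s , λ x∈B″ → A⊆B (closedA (closure-monotone s B⊆A x∈B″))

module Residuation (X Y : Set) (I : X → Y → Set) (n : ℕ) (i : Fin n → Sort) (o : Sort)
                 (R : Polarity.Z X Y I o → ((j : Fin n) → Polarity.Z X Y I (i j)) → Set)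
                 (k : Fin n) where
  open Polarity X Y I
  open ClosureProperties X Y I
  open Rel n i o R

  IsResidualAt : ∀ {ℓ} → Tuple 0ℓ → Pred (Z o) 0ℓ → Pred (Z (i k)) ℓ → Set (lsuc 0ℓ ⊔ ℓ)
  IsResidualAt E G β = Galois (i k) β
    × ((F : Pred (Z (i k)) 0ℓ) → Galois (i k) F → (ᾱ (upd E k F) ⊆ G) ⇔ (F ⊆ β))

  IsResidualAt-resp-≐ : ∀ {ℓ ℓ′} {E : Tuple 0ℓ} {G : Pred (Z o) 0ℓ}
                        {β : Pred (Z (i k)) ℓ} {β′ : Pred (Z (i k)) ℓ′}
                      → β ≐ β′ → IsResidualAt E G β → IsResidualAt E G β′
  IsResidualAt-resp-≐ β≐β′ (galβ , residual) =
    Galois-resp-≐ (i k) β≐β′ galβ ,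
    λ F galF → ⊆-respʳ-≐ β≐β′ ⇔-∘ residual F galF

  residual≐βR/ : ∀ {E : Tuple 0ℓ} {G : Pred (Z o) 0ℓ} {β : Pred (Z (i k)) 0ℓ}
               → Galois o G → IsResidualAt E G β → β ≐ βR/ k E G
  residual≐βR/ {E} {G} {β} galG (galβ , residual) = β⊆βR/ , βR/⊆β
    where
    βR/⊆β : βR/ k E G ⊆ β
    βR/⊆β (F , galF , αF⊆G , z∈F) =
      Equivalence.to (residual F galF)
        (Equivalence.from (closure⊆⇔⊆ o galG) αF⊆G) z∈F

    β⊆βR/ : β ⊆ βR/ k E G
    β⊆βR/ z∈β = β , galβ ,
      Equivalence.to (closure⊆⇔⊆ o galG) (Equivalence.from (residual β galβ) (λ z∈β → z∈β)) ,
      z∈β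

theorem3p14 : (X Y : Set) (I : X → Y → Set)
    → let open Polarity X Y I in
      (n : ℕ) (i : Fin n → Sort) (o : Sort)
      (R : Z o → ((j : Fin n) → Z (i j)) → Set) (k : Fin n)
    → let open Rel n i o R in
      -- ᾱ_R is residuated in the k-th place, with residual β̄ valued in G(Z_{i_k})
      (Σ (Tuple 0ℓ → Pred (Z o) 0ℓ → Pred (Z (i k)) 0ℓ) λ β̄ →
         ((E : Tuple 0ℓ) (G : Pred (Z o) 0ℓ)
           → (∀ j → j ≢ k → Galois (i j) (E j)) → Galois o G
           → Galois (i k) (β̄ E G)
             × ((F : Pred (Z (i k)) 0ℓ) → Galois (i k) F
                → (ᾱ (upd E k F) ⊆ G) ⇔ (F ⊆ β̄ E G))))
    → (E : Tuple 0ℓ) (G : Pred (Z o) 0ℓ)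
    → (∀ j → j ≢ k → Galois (i j) (E j)) → Galois o G
    → Galois (i k) (βR/ k E G)
      × ((F : Pred (Z (i k)) 0ℓ) → Galois (i k) F
         → (ᾱ (upd E k F) ⊆ G) ⇔ (F ⊆ βR/ k E G))
theorem3p14 X Y I n i o R k (β̄ , β̄-residual) E G galE galG =
  IsResidualAt-resp-≐ (residual≐βR/ galG β̄-residualAt) β̄-residualAt
  where
  open Residuation X Y I n i o R k
  β̄-residualAt : IsResidualAt E G (β̄ E G)
  β̄-residualAt = β̄-residual E G galE galG
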